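{- For $0\le k\le\lfloor n/2\rfloor$ there is an explicit bijection $\psi:\mathcal{AP}_{n,n-2k}\to\mathcal{Y}_{n,k}\times\mathcal{DP}_k$ such that whenever $\psi(u)=(y,p)$ one has $w(u)=w(p)$, where weights are taken with respect to $b_{2i}=1$, $b_{2i+1}=0$ ($i\ge0$) and $\lambda_j=\lfloor (j+1)/2\rfloor\,t$ ($j\ge1$).
   Context: A Motzkin path of length $n$ is a lattice path from $(0,0)$ to $(n,0)$ never going below the $x$-axis, with steps $\mathsf{U}=(1,1)$, $\mathsf{L}=(1,0)$, $\mathsf{D}=(1,-1)$; the height of a step is the $y$-coordinate of its starting point. An André path is a Motzkin path with no level step at odd height; $\mathcal{AP}_{n,m}$ is the set of André paths of length $n$ with exactly $m$ level steps. A Dyck path is a Motzkin path without level steps; $\mathcal{DP}_k$ is the set of Dyck paths of half-length $k$ (length $2k$). $\mathcal{Y}_{n,k}=\{(y_1,\dots,y_{k+1})\in\mathbb{N}^{k+1}: y_1+\cdots+y_{k+1}=n-2k\}$. Given $(b_i)_{i\ge0},(\lambda_i)_{i\ge1}$, an up step has weight $1$, a level step at height $i$ weight $b_i$, a down step at height $i$ weight $\lambda_i$, and $w(\cdot)$ of a path is the product of its step weights. -}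

module Defs where

open import Data.Nat.Base using (ℕ; zero; suc; _+_; _*_; _∸_; ⌊_/2⌋)
open import Data.Bool.Base using (Bool; true; false; _∧_; not; T)
open import Data.List.Base using (List; []; _∷_; length)
open import Data.Nat.ListAction using (sum)
open import Data.Vec.Base using (Vec; toList)
open import Data.Product.Base using (Σ; _×_)
open import Relation.Binary.PropositionalEquality using (_≡_)

-- Steps: U = (1,1), L = (1,0), D = (1,-1)
data Step : Set where
  U L D : Step

isOdd : ℕ → Bool
isOdd zero = false
isOdd (suc n) = not (isOdd n)

motzFrom : ℕ → List Step → Bool
motzFrom zero    []      = true
motzFrom (suc h) []      = false
motzFrom h       (U ∷ s) = motzFrom (suc h) s
motzFrom h       (L ∷ s) = motzFrom h s
motzFrom zero    (D ∷ s) = false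
motzFrom (suc h) (D ∷ s) = motzFrom h s

isMotzkin : List Step → Bool
isMotzkin = motzFrom 0

noOddLevelFrom : ℕ → List Step → Bool
noOddLevelFrom h       []      = true
noOddLevelFrom h       (U ∷ s) = noOddLevelFrom (suc h) s
noOddLevelFrom h       (L ∷ s) = not (isOdd h) ∧ noOddLevelFrom h s
noOddLevelFrom zero    (D ∷ s) = noOddLevelFrom zero s
noOddLevelFrom (suc h) (D ∷ s) = noOddLevelFrom h s

noLevel : List Step → Bool
noLevel []      = true
noLevel (U ∷ s) = noLevel s
noLevel (L ∷ s) = false
noLevel (D ∷ s) = noLevel s

countL : List Step → ℕ
countL []      = 0
countL (U ∷ s) = countL s
countL (L ∷ s) = suc (countL s)
countL (D ∷ s) = countL s

AP : ℕ → ℕ → Set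
AP n m = Σ (Vec Step n) λ v →
  T (isMotzkin (toList v)) × T (noOddLevelFrom 0 (toList v)) × countL (toList v) ≡ m

DP : ℕ → Set
DP k = Σ (Vec Step (2 * k)) λ v → T (isMotzkin (toList v)) × T (noLevel (toList v))

Y : ℕ → ℕ → Set
Y n k = Σ (Vec ℕ (suc k)) λ y → sum (toList y) ≡ n ∸ 2 * k

-- weight of a step list started at height h, for weights b (level) and lam (down);
-- an up step has weight 1, a level step at height i weight b i, a down step at
-- height i weight lam i (height = y-coordinate of the starting point)
weightFrom : (ℕ → ℕ) → (ℕ → ℕ) → ℕ → List Step → ℕ
weightFrom b lam h       []      = 1
weightFrom b lam h       (U ∷ s) = weightFrom b lam (suc h) s
weightFrom b lam h       (L ∷ s) = b h * weightFrom b lam h s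
weightFrom b lam zero    (D ∷ s) = lam zero * weightFrom b lam zero s
weightFrom b lam (suc h) (D ∷ s) = lam (suc h) * weightFrom b lam h s

w : (ℕ → ℕ) → (ℕ → ℕ) → List Step → ℕ
w b lam = weightFrom b lam 0

bAndre : ℕ → ℕ
bAndre i with isOdd i
... | true  = 0
... | false = 1

-- λ_j = ⌊(j+1)/2⌋ t  (only j ≥ 1 is ever used on Motzkin paths)
lamAndre : ℕ → ℕ → ℕ
lamAndre t j = ⌊ suc j /2⌋ * t

wAndre : ℕ → List Step → ℕ
wAndre t = w bAndre (lamAndre t)

-- In an André path started at even height, a step leaving an even height is
-- either a level step or a non-level step to an odd height, and from an odd
-- height the next step must be non-level and returns to an even height. So the
-- path is y₁ level steps, a pair of non-level steps, y₂ level steps, …, a pair,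
-- y_{k+1} level steps. Deleting the level steps leaves a Dyck path p; the runs
-- y form an element of Y n k. Every deleted level step sits at even height and
-- weighs 1, and each remaining step keeps its height, so w(u) = w(p).
module Submission where

open import Defs
open import Data.Bool.Base using (false; true; not; T)
open import Data.Bool.Properties using (T-irrelevant; not-involutive)
open import Data.Empty using (⊥-elim)
open import Data.List.Base using (List; []; _∷_; length; replicate; _++_)
open import Data.List.Properties using (length-++; length-replicate)
open import Data.Nat.Base using (ℕ; zero; suc; _+_; _*_; _∸_; _≤_; ⌊_/2⌋; ⌈_/2⌉)
open import Data.Nat.ListAction using (sum)
open import Data.Nat.Properties
  using (≡-irrelevant; suc-injective; +-identityʳ; +-cancelˡ-≡; *-suc; *-cancelˡ-≡;
         m∸n+n≡m; *-monoʳ-≤; +-monoʳ-≤; ⌊n/2⌋≤⌈n/2⌉; ⌊n/2⌋+⌈n/2⌉≡n; module ≤-Reasoning)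
open import Data.Nat.Tactic.RingSolver using (solve-∀)
open import Data.Unit.Base using (tt)
open import Data.Product.Base using (Σ; _×_; _,_; proj₁; proj₂)
open import Data.Product.Function.NonDependent.Propositional using (_×-↔_)
open import Data.Vec.Base as Vec using (Vec; toList)
open import Data.Vec.Relation.Binary.Equality.Cast using (cast-is-id)
open import Data.Vec.Properties
  using (toList-injective; toList-cast; toList∘fromList; length-toList)
open import Function.Base using (_∘_)
open import Function.Bundles using (_↔_; Inverse; mk↔ₛ′)
open import Function.Properties.Inverse using (↔-sym; ↔-trans)
open import Relation.Binary.PropositionalEquality
  using (_≡_; refl; sym; trans; cong; cong₂; subst; module ≡-Reasoning)
open import Relation.Nullary.Irrelevant using (Irrelevant)

private variable
  A : Set
  a b : Step
  h k n y : ℕ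
  ys : List ℕ
  s s′ p u : List Step

×-irrelevant : {B : Set} → Irrelevant A → Irrelevant B → Irrelevant (A × B)
×-irrelevant irrA irrB (x , y) (x′ , y′) = cong₂ _,_ (irrA x x′) (irrB y y′)

proj₁-injective : {B : A → Set} → (∀ x → Irrelevant (B x)) →
                  {u v : Σ A B} → proj₁ u ≡ proj₁ v → u ≡ v
proj₁-injective irr {x , b} {.x , b′} refl = cong (x ,_) (irr x b b′)

ListOf : ℕ → (List A → Set) → Set
ListOf {A} n P = Σ (List A) λ l → length l ≡ n × P l

toVec : (l : List A) → length l ≡ n → Vec A n
toVec l eq = Vec.cast eq (Vec.fromList l)

toList-toVec : (l : List A) (eq : length l ≡ n) → toList (toVec l eq) ≡ l
toList-toVec l eq = trans (toList-cast eq (Vec.fromList l)) (toList∘fromList l)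

module _ (P : List A → Set) (P-irrelevant : ∀ l → Irrelevant (P l)) where

  Σ-Vec↔ListOf : (Σ (Vec A n) (P ∘ toList)) ↔ ListOf n P
  Σ-Vec↔ListOf {n} = mk↔ₛ′ to from to∘from from∘to
    where
    to : Σ (Vec A n) (P ∘ toList) → ListOf n P
    to (v , x) = toList v , length-toList v , x

    from : ListOf n P → Σ (Vec A n) (P ∘ toList)
    from (l , eq , x) = toVec l eq , subst P (sym (toList-toVec l eq)) x

    irrelevant : ∀ l → Irrelevant (length l ≡ n × P l)
    irrelevant l = ×-irrelevant ≡-irrelevant (P-irrelevant l)

    to∘from : ∀ x → to (from x) ≡ x
    to∘from (l , eq , _) = proj₁-injective irrelevant (toList-toVec l eq)

    from∘to : ∀ x → from (to x) ≡ x
    from∘to (v , _) =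
      proj₁-injective (P-irrelevant ∘ toList) (trans (sym (cast-is-id refl _))
        (toList-injective refl (toVec (toList v) (length-toList v)) v
          (toList-toVec (toList v) (length-toList v))))

  toList-from-Σ-Vec↔ListOf : (x : ListOf n P) →
                             toList (proj₁ (Inverse.from Σ-Vec↔ListOf x)) ≡ proj₁ x
  toList-from-Σ-Vec↔ListOf (l , eq , _) = toList-toVec l eq

data Even : ℕ → Set where
  zero : Even 0
  2+_  : Even h → Even (suc (suc h))

Even⇒isOdd≡false : Even h → isOdd h ≡ false
Even⇒isOdd≡false zero     = refl
Even⇒isOdd≡false (2+ ev) = trans (not-involutive _) (Even⇒isOdd≡false ev)

Even⇒isOdd-suc≡true : Even h → isOdd (suc h) ≡ true
Even⇒isOdd-suc≡true ev = cong not (Even⇒isOdd≡false ev)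

motzFrom-U : ∀ h s → motzFrom h (U ∷ s) ≡ motzFrom (suc h) s
motzFrom-U zero    s = refl
motzFrom-U (suc h) s = refl

motzFrom-L : ∀ h s → motzFrom h (L ∷ s) ≡ motzFrom h s
motzFrom-L zero    s = refl
motzFrom-L (suc h) s = refl

motzFrom-∷-cong : (∀ h → motzFrom h s ≡ motzFrom h s′) →
                  ∀ a h → motzFrom h (a ∷ s) ≡ motzFrom h (a ∷ s′)
motzFrom-∷-cong {s} {s′} eq U h =
  trans (motzFrom-U h s) (trans (eq (suc h)) (sym (motzFrom-U h s′)))
motzFrom-∷-cong {s} {s′} eq L h =
  trans (motzFrom-L h s) (trans (eq h) (sym (motzFrom-L h s′)))
motzFrom-∷-cong eq D zero    = refl
motzFrom-∷-cong eq D (suc h) = eq h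

noOddLevelFrom-L-even : Even h → ∀ s → noOddLevelFrom h (L ∷ s) ≡ noOddLevelFrom h s
noOddLevelFrom-L-even ev s rewrite Even⇒isOdd≡false ev = refl

noOddLevelFrom-L-odd : isOdd h ≡ true → ∀ s → noOddLevelFrom h (L ∷ s) ≡ false
noOddLevelFrom-L-odd odd s rewrite odd = refl

length-levels : ∀ y s → length (replicate y L ++ s) ≡ y + length s
length-levels y s = trans (length-++ (replicate y L)) (cong (_+ length s) (length-replicate y))

countL-levels : ∀ y s → countL (replicate y L ++ s) ≡ y + countL s
countL-levels zero    s = refl
countL-levels (suc y) s = cong suc (countL-levels y s)

motzFrom-levels : ∀ h y s → motzFrom h (replicate y L ++ s) ≡ motzFrom h s
motzFrom-levels h zero    s = refl
motzFrom-levels h (suc y) s = trans (motzFrom-L h _) (motzFrom-levels h y s)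

noOddLevelFrom-levels : Even h → ∀ y s →
                        noOddLevelFrom h (replicate y L ++ s) ≡ noOddLevelFrom h s
noOddLevelFrom-levels ev zero    s = refl
noOddLevelFrom-levels ev (suc y) s =
  trans (noOddLevelFrom-L-even ev (replicate y L ++ s)) (noOddLevelFrom-levels ev y s)

data NonLevel : Step → Set where
  up   : NonLevel U
  down : NonLevel D

countL-nonLevel : NonLevel a → countL (a ∷ s) ≡ countL s
countL-nonLevel up   = refl
countL-nonLevel down = refl

noLevel-∷ : ∀ a → T (noLevel (a ∷ s)) → NonLevel a × T (noLevel s)
noLevel-∷ U nl = up , nl
noLevel-∷ D nl = down , nl

data LevelsAndPairs : List Step → Set where
  []    : LevelsAndPairs []
  level : LevelsAndPairs s → LevelsAndPairs (L ∷ s)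
  pair  : NonLevel a → NonLevel b → LevelsAndPairs s → LevelsAndPairs (a ∷ b ∷ s)

data NonLevelPairs : List ℕ → List Step → Set where
  []   : NonLevelPairs [] []
  pair : NonLevel a → NonLevel b → NonLevelPairs ys p → NonLevelPairs (y ∷ ys) (a ∷ b ∷ p)

andre⇒levelsAndPairs : Even h → ∀ u → T (motzFrom h u) → T (noOddLevelFrom h u) →
                       LevelsAndPairs u
andre⇒levelsAndPairs ev [] _ _ = []
andre⇒levelsAndPairs {h} ev (L ∷ s) mo no =
  level (andre⇒levelsAndPairs ev s (subst T (motzFrom-L h s) mo)
                                   (subst T (noOddLevelFrom-L-even ev s) no))
andre⇒levelsAndPairs {h} ev (U ∷ []) mo _ = ⊥-elim (subst T (motzFrom-U h []) mo)
andre⇒levelsAndPairs ev (U ∷ L ∷ s) _ no =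
  ⊥-elim (subst T (noOddLevelFrom-L-odd (Even⇒isOdd-suc≡true ev) s) no)
andre⇒levelsAndPairs {h} ev (U ∷ U ∷ s) mo no =
  pair up up (andre⇒levelsAndPairs (2+ ev) s (subst T (motzFrom-U h (U ∷ s)) mo) no)
andre⇒levelsAndPairs {h} ev (U ∷ D ∷ s) mo no =
  pair up down (andre⇒levelsAndPairs ev s (subst T (motzFrom-U h (D ∷ s)) mo) no)
andre⇒levelsAndPairs (2+ ev) (D ∷ L ∷ s) _ no =
  ⊥-elim (subst T (noOddLevelFrom-L-odd (Even⇒isOdd-suc≡true ev) s) no)
andre⇒levelsAndPairs (2+ ev) (D ∷ U ∷ s) mo no = pair down up (andre⇒levelsAndPairs (2+ ev) s mo no)
andre⇒levelsAndPairs (2+ ev) (D ∷ D ∷ s) mo no = pair down down (andre⇒levelsAndPairs ev s mo no)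
andre⇒levelsAndPairs (2+ ev) (D ∷ []) () _
andre⇒levelsAndPairs zero    (D ∷ _) () _

-- (y₁ , y₂ … y_{k+1} , p): the runs of level steps, and the path of the other steps.
Decomposition : Set
Decomposition = ℕ × List ℕ × List Step

merge : ℕ → List ℕ → List Step → List Step
merge y (z ∷ zs) (a ∷ b ∷ p) = replicate y L ++ a ∷ b ∷ merge z zs p
merge y _        p           = replicate y L ++ p

addLevels : ℕ → Decomposition → Decomposition
addLevels x (y , ys , p) = x + y , ys , p

addPair : Step → Step → Decomposition → Decomposition
addPair a b (y , ys , p) = 0 , y ∷ ys , a ∷ b ∷ p

split : List Step → Decomposition
split []          = 0 , [] , []
split (L ∷ u)     = addLevels 1 (split u)
split (a ∷ [])    = 0 , [] , a ∷ []
split (a ∷ b ∷ u) = addPair a b (split u)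

split-pair : NonLevel a → ∀ b u → split (a ∷ b ∷ u) ≡ addPair a b (split u)
split-pair up   b u = refl
split-pair down b u = refl

split-levels : ∀ y s → split (replicate y L ++ s) ≡ addLevels y (split s)
split-levels zero    s = refl
split-levels (suc y) s = cong (addLevels 1) (split-levels y s)

merge-suc : ∀ y ys p → merge (suc y) ys p ≡ L ∷ merge y ys p
merge-suc y []       p           = refl
merge-suc y (z ∷ zs) []          = refl
merge-suc y (z ∷ zs) (a ∷ [])    = refl
merge-suc y (z ∷ zs) (a ∷ b ∷ p) = refl

merge-split : LevelsAndPairs u → let (y , ys , p) = split u in merge y ys p ≡ u
merge-split []                 = refl
merge-split (level {s} ls)     =
  let (y , ys , p) = split s in trans (merge-suc y ys p) (cong (L ∷_) (merge-split ls))
merge-split (pair {a = a} {b = b} {s = s} na _ ls) rewrite split-pair na b s =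
  cong (λ t → a ∷ b ∷ t) (merge-split ls)

nonLevelPairs-split : LevelsAndPairs u → let (_ , ys , p) = split u in NonLevelPairs ys p
nonLevelPairs-split []                           = []
nonLevelPairs-split (level ls)                   = nonLevelPairs-split ls
nonLevelPairs-split (pair {b = b} {s} na nb ls) =
  subst (λ (_ , ys , p) → NonLevelPairs ys p) (sym (split-pair na b s))
        (pair na nb (nonLevelPairs-split ls))

split-merge : NonLevelPairs ys p → split (merge y ys p) ≡ (y , ys , p)
split-merge {y = y} [] = trans (split-levels y []) (cong (λ y′ → y′ , [] , []) (+-identityʳ y))
split-merge {y = y} (pair {a = a} {b = b} {ys = zs} {p = p} {y = z} na _ ps) = begin
  split (replicate y L ++ a ∷ b ∷ merge z zs p)
    ≡⟨ split-levels y _ ⟩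
  addLevels y (split (a ∷ b ∷ merge z zs p))
    ≡⟨ cong (addLevels y) (split-pair na b _) ⟩
  addLevels y (addPair a b (split (merge z zs p)))
    ≡⟨ cong (addLevels y ∘ addPair a b) (split-merge ps) ⟩
  (y + 0 , z ∷ zs , a ∷ b ∷ p)
    ≡⟨ cong (λ y′ → y′ , z ∷ zs , a ∷ b ∷ p) (+-identityʳ y) ⟩
  (y , z ∷ zs , a ∷ b ∷ p)
    ∎
  where open ≡-Reasoning

length-merge : NonLevelPairs ys p → length (merge y ys p) ≡ y + sum ys + length p
length-merge {y = y} [] = trans (length-levels y []) (sym (+-identityʳ (y + 0)))
length-merge {y = y} (pair {ys = zs} {p = p} {y = z} _ _ ps) = begin
  length (replicate y L ++ _ ∷ _ ∷ merge z zs p) ≡⟨ length-levels y _ ⟩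
  y + (2 + length (merge z zs p))                ≡⟨ cong (λ l → y + (2 + l)) (length-merge ps) ⟩
  y + (2 + (z + sum zs + length p))              ≡⟨ regroup y (z + sum zs) (length p) ⟩
  y + (z + sum zs) + (2 + length p)              ∎
  where
  open ≡-Reasoning
  regroup : ∀ y r l → y + (2 + (r + l)) ≡ y + r + (2 + l)
  regroup = solve-∀

countL-merge : NonLevelPairs ys p → countL (merge y ys p) ≡ y + sum ys
countL-merge {y = y} [] = countL-levels y []
countL-merge {y = y} (pair {a = a} {b = b} {ys = zs} {p = p} {y = z} na nb ps) = begin
  countL (replicate y L ++ a ∷ b ∷ merge z zs p) ≡⟨ countL-levels y _ ⟩
  y + countL (a ∷ b ∷ merge z zs p)              ≡⟨ cong (y +_) pair-uncounted ⟩
  y + countL (merge z zs p)                      ≡⟨ cong (y +_) (countL-merge ps) ⟩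
  y + (z + sum zs)                               ∎
  where
  open ≡-Reasoning
  pair-uncounted : countL (a ∷ b ∷ merge z zs p) ≡ countL (merge z zs p)
  pair-uncounted = trans (countL-nonLevel na) (countL-nonLevel nb)

motzFrom-merge : NonLevelPairs ys p → ∀ h → motzFrom h (merge y ys p) ≡ motzFrom h p
motzFrom-merge {y = y} [] h = motzFrom-levels h y []
motzFrom-merge {y = y} (pair {a = a} {b = b} _ _ ps) h =
  trans (motzFrom-levels h y _) (motzFrom-∷-cong (motzFrom-∷-cong (motzFrom-merge ps) b) a h)

noOddLevelFrom-merge : NonLevelPairs ys p → Even h → T (motzFrom h p) →
                       T (noOddLevelFrom h (merge y ys p))
noOddLevelFrom-merge {y = y} [] ev _ = subst T (sym (noOddLevelFrom-levels ev y [])) tt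
noOddLevelFrom-merge {h = h} {y = y} (pair up up ps) ev mo =
  subst T (sym (noOddLevelFrom-levels ev y _))
    (noOddLevelFrom-merge ps (2+ ev) (subst T (motzFrom-U h _) mo))
noOddLevelFrom-merge {h = h} {y = y} (pair up down ps) ev mo =
  subst T (sym (noOddLevelFrom-levels ev y _))
    (noOddLevelFrom-merge ps ev (subst T (motzFrom-U h _) mo))
noOddLevelFrom-merge {y = y} (pair down up ps) (2+ ev) mo =
  subst T (sym (noOddLevelFrom-levels (2+ ev) y _)) (noOddLevelFrom-merge ps (2+ ev) mo)
noOddLevelFrom-merge {y = y} (pair down down ps) (2+ ev) mo =
  subst T (sym (noOddLevelFrom-levels (2+ ev) y _)) (noOddLevelFrom-merge ps ev mo)
noOddLevelFrom-merge (pair down _ _) zero ()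

module _ (bl lam : ℕ → ℕ) (bl-even : ∀ {h} → Even h → bl h ≡ 1) where

  weightFrom-levels : Even h → ∀ y s →
                      weightFrom bl lam h (replicate y L ++ s) ≡ weightFrom bl lam h s
  weightFrom-levels     ev zero    s = refl
  weightFrom-levels {h} ev (suc y) s = begin
    bl h * rest ≡⟨ cong (_* rest) (bl-even ev) ⟩
    1 * rest    ≡⟨ +-identityʳ rest ⟩
    rest        ≡⟨ weightFrom-levels ev y s ⟩
    weightFrom bl lam h s ∎
    where
    open ≡-Reasoning
    rest : ℕ
    rest = weightFrom bl lam h (replicate y L ++ s)

  weightFrom-merge : NonLevelPairs ys p → Even h → T (motzFrom h p) →
                     weightFrom bl lam h (merge y ys p) ≡ weightFrom bl lam h p
  weightFrom-merge {y = y} [] ev _ = weightFrom-levels ev y []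
  weightFrom-merge {h = h} {y = y} (pair up up ps) ev mo =
    trans (weightFrom-levels ev y _) (weightFrom-merge ps (2+ ev) (subst T (motzFrom-U h _) mo))
  weightFrom-merge {h = h} {y = y} (pair up down ps) ev mo =
    trans (weightFrom-levels ev y _)
      (cong (lam (suc h) *_) (weightFrom-merge ps ev (subst T (motzFrom-U h _) mo)))
  weightFrom-merge {h = suc (suc h)} {y = y} (pair down up ps) (2+ ev) mo =
    trans (weightFrom-levels (2+ ev) y _)
      (cong (lam (suc (suc h)) *_) (weightFrom-merge ps (2+ ev) mo))
  weightFrom-merge {h = suc (suc h)} {y = y} (pair down down ps) (2+ ev) mo =
    trans (weightFrom-levels (2+ ev) y _)
      (cong (λ x → lam (suc (suc h)) * (lam (suc h) * x)) (weightFrom-merge ps ev mo))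
  weightFrom-merge (pair down _ _) zero ()

nonLevelPairs⇒noLevel : NonLevelPairs ys p → T (noLevel p)
nonLevelPairs⇒noLevel []                  = tt
nonLevelPairs⇒noLevel (pair up   up   ps) = nonLevelPairs⇒noLevel ps
nonLevelPairs⇒noLevel (pair up   down ps) = nonLevelPairs⇒noLevel ps
nonLevelPairs⇒noLevel (pair down up   ps) = nonLevelPairs⇒noLevel ps
nonLevelPairs⇒noLevel (pair down down ps) = nonLevelPairs⇒noLevel ps

length-nonLevelPairs : NonLevelPairs ys p → length p ≡ 2 * length ys
length-nonLevelPairs []                      = refl
length-nonLevelPairs (pair {ys = ys} _ _ ps) =
  trans (cong (2 +_) (length-nonLevelPairs ps)) (sym (*-suc 2 (length ys)))

noLevel⇒nonLevelPairs : ∀ ys p → T (noLevel p) → length p ≡ 2 * length ys → NonLevelPairs ys p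
noLevel⇒nonLevelPairs []       []          _  _  = []
noLevel⇒nonLevelPairs (_ ∷ ys) (a ∷ b ∷ p) nl eq =
  let (na , nl′) = noLevel-∷ a nl
      (nb , nl″) = noLevel-∷ b nl′
  in pair na nb (noLevel⇒nonLevelPairs ys p nl″ (suc-injective (suc-injective (trans eq (*-suc 2 _)))))
noLevel⇒nonLevelPairs (_ ∷ ys) (_ ∷ [])    _  eq with trans eq (*-suc 2 (length ys))
... | ()
noLevel⇒nonLevelPairs (_ ∷ _)  []          _  ()
noLevel⇒nonLevelPairs []       (_ ∷ _)     _  ()

nonLevelPairs-sizes : ∀ {k n r ys p} → 2 * k ≤ n → NonLevelPairs ys p →
                      r + length p ≡ n → r ≡ n ∸ 2 * k → length ys ≡ k × length p ≡ 2 * k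
nonLevelPairs-sizes {k} {n} {ys = ys} {p} 2k≤n ps len refl = length-ys , length-p
  where
  length-p : length p ≡ 2 * k
  length-p = +-cancelˡ-≡ (n ∸ 2 * k) _ _ (trans len (sym (m∸n+n≡m 2k≤n)))
  length-ys : length ys ≡ k
  length-ys = *-cancelˡ-≡ _ _ 2 (trans (sym (length-nonLevelPairs ps)) length-p)

IsAndre : ℕ → List Step → Set
IsAndre m u = T (isMotzkin u) × T (noOddLevelFrom 0 u) × countL u ≡ m

IsDyck : List Step → Set
IsDyck p = T (isMotzkin p) × T (noLevel p)

IsAndre-irrelevant : ∀ m u → Irrelevant (IsAndre m u)
IsAndre-irrelevant _ _ = ×-irrelevant T-irrelevant (×-irrelevant T-irrelevant ≡-irrelevant)

IsDyck-irrelevant : ∀ p → Irrelevant (IsDyck p)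
IsDyck-irrelevant _ = ×-irrelevant T-irrelevant T-irrelevant

module AndreDecomposition (u : List Step) (mo : T (isMotzkin u)) (no : T (noOddLevelFrom 0 u))
  where

  shape : LevelsAndPairs u
  shape = andre⇒levelsAndPairs zero u mo no

  firstRun : ℕ
  firstRun = proj₁ (split u)

  laterRuns : List ℕ
  laterRuns = proj₁ (proj₂ (split u))

  dyckPart : List Step
  dyckPart = proj₂ (proj₂ (split u))

  pairs : NonLevelPairs laterRuns dyckPart
  pairs = nonLevelPairs-split shape

  merged : merge firstRun laterRuns dyckPart ≡ u
  merged = merge-split shape

  dyckPart-motzkin : T (isMotzkin dyckPart)
  dyckPart-motzkin = subst T (trans (sym (cong isMotzkin merged)) (motzFrom-merge pairs 0)) mo

  weight-dyckPart : ∀ bl lam → (∀ {h} → Even h → bl h ≡ 1) → w bl lam u ≡ w bl lam dyckPart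
  weight-dyckPart bl lam bl-even =
    trans (cong (w bl lam) (sym merged)) (weightFrom-merge bl lam bl-even pairs zero dyckPart-motzkin)

module _ {n k : ℕ} (2k≤n : 2 * k ≤ n) where

  andre↔runs×dyck : ListOf n (IsAndre (n ∸ 2 * k)) ↔
                    (ListOf (suc k) (λ ys → sum ys ≡ n ∸ 2 * k) × ListOf (2 * k) IsDyck)
  andre↔runs×dyck = mk↔ₛ′ to from to∘from from∘to
    where
    to : ListOf n (IsAndre (n ∸ 2 * k)) →
         ListOf (suc k) (λ ys → sum ys ≡ n ∸ 2 * k) × ListOf (2 * k) IsDyck
    to (u , len , mo , no , c) =
        (firstRun ∷ laterRuns , cong suc (proj₁ sizes) , runs)
      , (dyckPart , proj₂ sizes , dyckPart-motzkin , nonLevelPairs⇒noLevel pairs)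
      where
      open AndreDecomposition u mo no
      runs : firstRun + sum laterRuns ≡ n ∸ 2 * k
      runs = trans (sym (countL-merge pairs)) (trans (cong countL merged) c)
      sizes : length laterRuns ≡ k × length dyckPart ≡ 2 * k
      sizes = nonLevelPairs-sizes 2k≤n pairs
                (trans (sym (length-merge pairs)) (trans (cong length merged) len)) runs

    pairsOf : ∀ {ys p} → length ys ≡ k → length p ≡ 2 * k → T (noLevel p) → NonLevelPairs ys p
    pairsOf {ys} {p} len-ys len-p nl =
      noLevel⇒nonLevelPairs ys p nl (trans len-p (cong (2 *_) (sym len-ys)))

    from : ListOf (suc k) (λ ys → sum ys ≡ n ∸ 2 * k) × ListOf (2 * k) IsDyck →
           ListOf n (IsAndre (n ∸ 2 * k))
    from ((y ∷ ys , len-ys , runs) , (p , len-p , mo , nl)) =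
      merge y ys p ,
      trans (length-merge ps) (trans (cong₂ _+_ runs len-p) (m∸n+n≡m 2k≤n)) ,
      subst T (sym (motzFrom-merge ps 0)) mo ,
      noOddLevelFrom-merge ps zero mo ,
      trans (countL-merge ps) runs
      where
      ps : NonLevelPairs ys p
      ps = pairsOf (suc-injective len-ys) len-p nl

    to∘from : ∀ x → to (from x) ≡ x
    to∘from ((y ∷ ys , len-ys , _) , (p , len-p , _ , nl)) =
      cong₂ _,_
        (proj₁-injective (λ _ → ×-irrelevant ≡-irrelevant ≡-irrelevant)
                         (cong (λ (y , ys , _) → y ∷ ys) split-merged))
        (proj₁-injective (λ p → ×-irrelevant ≡-irrelevant (IsDyck-irrelevant p))
                         (cong (proj₂ ∘ proj₂) split-merged))
      where
      split-merged : split (merge y ys p) ≡ (y , ys , p)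
      split-merged = split-merge (pairsOf (suc-injective len-ys) len-p nl)

    from∘to : ∀ x → from (to x) ≡ x
    from∘to (u , _ , mo , no , _) =
      proj₁-injective (λ u → ×-irrelevant ≡-irrelevant (IsAndre-irrelevant _ u))
                      (AndreDecomposition.merged u mo no)

k≤⌊n/2⌋⇒2k≤n : ∀ n → k ≤ ⌊ n /2⌋ → 2 * k ≤ n
k≤⌊n/2⌋⇒2k≤n {k} n k≤n/2 = begin
  2 * k                   ≤⟨ *-monoʳ-≤ 2 k≤n/2 ⟩
  ⌊ n /2⌋ + (⌊ n /2⌋ + 0) ≡⟨ cong (⌊ n /2⌋ +_) (+-identityʳ ⌊ n /2⌋) ⟩
  ⌊ n /2⌋ + ⌊ n /2⌋       ≤⟨ +-monoʳ-≤ ⌊ n /2⌋ (⌊n/2⌋≤⌈n/2⌉ n) ⟩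
  ⌊ n /2⌋ + ⌈ n /2⌉       ≡⟨ ⌊n/2⌋+⌈n/2⌉≡n n ⟩
  n                       ∎
  where open ≤-Reasoning

bAndre-even : Even h → bAndre h ≡ 1
bAndre-even {h} ev with isOdd h | Even⇒isOdd≡false ev
... | false | _ = refl

lemma3p6 : (n k : ℕ) → k ≤ ⌊ n /2⌋ →
    Σ (AP n (n ∸ 2 * k) ↔ (Y n k × DP k)) λ ψ →
      (t : ℕ) (u : AP n (n ∸ 2 * k)) →
        wAndre t (toList (proj₁ u)) ≡ wAndre t (toList (proj₁ (proj₂ (Inverse.to ψ u))))
lemma3p6 n k k≤n/2 = ψ , weight
  where
  vecs↔lists : AP n (n ∸ 2 * k) ↔ ListOf n (IsAndre (n ∸ 2 * k))
  vecs↔lists = Σ-Vec↔ListOf (IsAndre (n ∸ 2 * k)) (IsAndre-irrelevant _)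

  lists↔vecs : (ListOf (suc k) (λ ys → sum ys ≡ n ∸ 2 * k) × ListOf (2 * k) IsDyck) ↔
               (Y n k × DP k)
  lists↔vecs = ↔-sym (Σ-Vec↔ListOf (λ ys → sum ys ≡ n ∸ 2 * k) (λ _ → ≡-irrelevant)
                      ×-↔ Σ-Vec↔ListOf IsDyck IsDyck-irrelevant)

  runs×dyck : ListOf n (IsAndre (n ∸ 2 * k)) ↔
              (ListOf (suc k) (λ ys → sum ys ≡ n ∸ 2 * k) × ListOf (2 * k) IsDyck)
  runs×dyck = andre↔runs×dyck (k≤⌊n/2⌋⇒2k≤n n k≤n/2)

  ψ : AP n (n ∸ 2 * k) ↔ (Y n k × DP k)
  ψ = ↔-trans vecs↔lists (↔-trans runs×dyck lists↔vecs)

  weight : (t : ℕ) (u : AP n (n ∸ 2 * k)) →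
           wAndre t (toList (proj₁ u)) ≡ wAndre t (toList (proj₁ (proj₂ (Inverse.to ψ u))))
  weight t u@(v , mo , no , _) =
    trans (weight-dyckPart bAndre (lamAndre t) bAndre-even)
          (cong (wAndre t) (sym (toList-from-Σ-Vec↔ListOf IsDyck IsDyck-irrelevant
            (proj₂ (Inverse.to runs×dyck (Inverse.to vecs↔lists u))))))
    where open AndreDecomposition (toList v) mo no
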